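{- Let $K=\mathbb{Q}(\sqrt{ -d})$ with $d>0$ squarefree and discriminant $-D$, and let $S$ be a finite set of rational primes with associated set $T$. Suppose that for every rational $y\in[0,1]$ there exists $c\in T$ such that $\{cy\}<\sqrt{3}/\sqrt{D}$ or $\{cy\}>1-\sqrt{3}/\sqrt{D}$. Then $K$ is $S$-norm-Euclidean.
   Context: $\{x\}=x-\lfloor x\rfloor$ denotes the fractional part. $D=4d$ if $-d\equiv 2,3\pmod 4$ and $D=d$ if $-d\equiv 1\pmod 4$. Put $w=\sqrt{ -d}$ if $-d\equiv 2,3\pmod 4$ and $w=(1+\sqrt{ -d})/2$ if $-d\equiv 1\pmod 4$. The norm is $N(x+y\sqrt{ -d})=x^2+dy^2$. $T$ is the set of positive integers all of whose prime factors lie in $S$ (so $1\in T$), and $\mathcal{O}_S=\{(a+bw)/c: a,b\in\mathbb{Z}, c\in T\}$. For nonzero $\xi\in K$, $N_S(\xi)$ is the positive rational obtained from $N(\xi)$ by deleting all primes of $S$ from the prime factorizations of its numerator and denominator; $N_S(0)=0$. $K$ is $S$-norm-Euclidean if for every $\xi\in K$ there exists $\gamma\in\mathcal{O}_S$ with $N_S(\xi-\gamma)<1$. -}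

module Defs where

open import Data.Nat as ℕ using (ℕ; zero; suc; _≤_; _<_; NonZero)
open import Data.Nat.Properties as ℕP using ()
open import Data.Nat.DivMod using (_/_; m≥n⇒m/n>0)
open import Data.Nat.Divisibility using (_∣_; _∣?_; ∣⇒≤)
open import Data.Nat.Primality using (Prime)
open import Data.Integer as ℤ using (ℤ; +_; ∣_∣)
open import Data.Rational as ℚ using (ℚ; ↥_; ↧ₙ_; floor; _-_; _<_; _>_; _+_; _*_; 0ℚ; 1ℚ)
open import Data.List using (List; []; _∷_)
open import Data.List.Membership.Propositional using (_∈_)
open import Data.Product using (Σ; _×_; _,_; ∃)
open import Data.Sum using (_⊎_)
open import Relation.Nullary using (yes; no)
open import Relation.Binary.PropositionalEquality using (_≡_)

InT : List ℕ → ℕ → Set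
InT S c = NonZero c × (∀ p → Prime p → p ∣ c → p ∈ S)

-- Divide out all factors p from n (fuel-bounded; fuel n suffices as p ≥ 2).
divOut : ℕ → ℕ → ℕ → ℕ
divOut zero p n = n
divOut (suc f) (suc (suc k)) n with suc (suc k) ∣? n
... | yes _ = divOut f (suc (suc k)) (n / suc (suc k))
... | no  _ = n
divOut (suc f) _ n = n

divOut-nz : ∀ f p n → NonZero n → NonZero (divOut f p n)
divOut-nz zero p n nz = nz
divOut-nz (suc f) zero n nz = nz
divOut-nz (suc f) (suc zero) n nz = nz
divOut-nz (suc f) (suc (suc k)) n nz with suc (suc k) ∣? n
... | yes p∣n = divOut-nz f (suc (suc k)) (n / suc (suc k))
                  (ℕ.>-nonZero (m≥n⇒m/n>0 (∣⇒≤ {{nz}} p∣n)))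
... | no  _ = nz

removeS : List ℕ → ℕ → ℕ
removeS [] n = n
removeS (p ∷ S) n = removeS S (divOut n p n)

removeS-nz : ∀ S n → NonZero n → NonZero (removeS S n)
removeS-nz [] n nz = nz
removeS-nz (p ∷ S) n nz = removeS-nz S (divOut n p n) (divOut-nz n p n nz)

-- The field K = ℚ(√-d); an element x + y√-d is the pair (x , y).

K : Set
K = ℚ × ℚ

_−K_ : K → K → K
(x , y) −K (x' , y') = (x - x' , y - y')

normK : ℕ → K → ℚ
normK d (x , y) = x * x + ((+ d) ℚ./ 1) * (y * y)

-- N_S(q) for a nonnegative rational q (N_S(0) = 0 automatically).
NS : List ℕ → ℚ → ℚ
NS S q = (+ removeS S ∣ ↥ q ∣) ℚ./ removeS S (↧ₙ q)
  where instance _ = removeS-nz S (↧ₙ q) (record { nonZero = _ })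

-- -d ≡ 1 (mod 4)  ⟺  d ≡ 3 (mod 4)
MinusDOneMod4 : ℕ → Set
MinusDOneMod4 d = d ℕ.% 4 ≡ 3

discD : ℕ → ℕ
discD d with d ℕ.% 4 ℕ.≟ 3
... | yes _ = d
... | no  _ = 4 ℕ.* d

-- γ = (a + b w)/c as an element of K.
mkOS : ℕ → ℤ → ℤ → (c : ℕ) → .{{NonZero c}} → K
mkOS d a b c with d ℕ.% 4 ℕ.≟ 3
... | yes _ = (((a ℚ./ 1) + (b ℚ./ 2)) * (+ 1 ℚ./ c) , (b ℚ./ 2) * (+ 1 ℚ./ c))
... | no  _ = (a ℚ./ c , b ℚ./ c)

InOS : ℕ → List ℕ → K → Set
InOS d S γ = Σ ℤ λ a → Σ ℤ λ b → Σ ℕ λ c → Σ (InT S c) λ cT →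
  γ ≡ mkOS d a b c {{Data.Product.proj₁ cT}}

SNormEuclidean : ℕ → List ℕ → Set
SNormEuclidean d S = ∀ (ξ : K) → Σ K λ γ → InOS d S γ × NS S (normK d (ξ −K γ)) ℚ.< 1ℚ

frac : ℚ → ℚ
frac x = x - (floor x ℚ./ 1)

Squarefree : ℕ → Set
Squarefree d = ∀ n → n ℕ.* n ∣ d → n ≡ 1

-- {t} < √3/√D  ⟺  {t}² · D < 3   (as {t} ≥ 0)
-- {t} > 1 - √3/√D  ⟺  (1 - {t})² · D < 3   (as 1 - {t} > 0)
FracCondition : ℕ → ℚ → Set
FracCondition D t =
  (frac t * frac t * ((+ D) ℚ./ 1) ℚ.< (+ 3) ℚ./ 1)
  ⊎ ((1ℚ - frac t) * (1ℚ - frac t) * ((+ D) ℚ./ 1) ℚ.< (+ 3) ℚ./ 1)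

{-# OPTIONS --safe #-}

-- Write ξ = (X + Y√−d)/(r s) with r free of the primes of S and s ∈ T, and put k = 2 if
-- −d ≡ 1 mod 4 and k = 1 otherwise, so that D = 4d/k².  For γ = (a + b w)/(c s) ∈ O_S write
-- ξ − γ = (A + B√−d)/(k r c s).  The hypothesis, applied to the fractional part of kY/r,
-- yields c ∈ T and b with D B² < 3 r², and rounding then yields a with 2|A| ≤ k r.  Hence
-- N(ξ − γ) = n/(r² (cs)²) with k² n = A² + d B² < k² r²; for k = 2 the division by 4 is exact
-- because A ≡ B (mod 2) and d ≡ 3 (mod 4).  Deleting the primes of S removes (cs)² and
-- leaves r² intact, as r is S-free, so N_S(ξ − γ) ≤ n/r² < 1.

module Submission where

open import Defs
open import Data.Nat as ℕ using (ℕ; zero; suc; NonZero; _^_)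
import Data.Nat.Properties as ℕP
open import Data.Nat.DivMod using (m/n*n≡m; m/n<m; m≥n⇒m/n>0; m≡m%n+[m/n]*n) renaming (_/_ to _div_)
open import Data.Nat.Divisibility using (_∣_; _∣?_; divides; ∣-trans; ∣-antisym; ∣⇒≤; ∣1⇒≡1; 0∣⇒≡0; m∣m*n)
open import Data.Nat.Primality using (Prime; euclidsLemma; prime⇒irreducible; prime⇒nonZero; ¬prime[0]; ¬prime[1])
open import Data.Nat.Primality.Factorisation using (factorise)
open import Data.Nat.Coprimality using (Coprime; coprime-divisor)
import Data.Nat.Tactic.RingSolver as ℕ-Ring
open import Algebra.Properties.CommutativeSemigroup ℕP.*-commutativeSemigroup using () renaming (interchange to *-interchange)
open import Data.Integer as ℤ using (ℤ; +_; -[1+_]; ∣_∣; _⊖_)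
import Data.Integer.Properties as ℤP
open import Data.Integer.DivMod using (a≡a%ℕn+[a/ℕn]*n; n%ℕd<d)
open import Data.Integer.Tactic.RingSolver using (solve-∀)
open import Data.Rational using (ℚ; _/_; _+_; _*_; _-_; -_; _<_; _≤_; 0ℚ; 1ℚ; ↥_; ↧_; ↧ₙ_; floor; toℚᵘ; fromℚᵘ)
import Data.Rational.Properties as ℚP
open import Data.Rational.Unnormalised as ℚᵘ using (*≡*; *<*; *≤*)
import Data.Rational.Unnormalised.Properties as ℚᵘP
open import Data.Rational.Solver using (module +-*-Solver)
open import Data.List using (List; []; _∷_)
open import Data.List.Membership.Propositional using (_∈_)
open import Data.List.Relation.Unary.Any using (here; there)
open import Data.List.Relation.Unary.All as All using (All; _∷_)
open import Data.Product using (Σ; _×_; _,_; ∃; ∃₂; proj₁)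
open import Data.Sum using (inj₁; inj₂; [_,_])
open import Data.Empty using (⊥-elim)
open import Relation.Nullary using (Dec; yes; no; ¬_)
open import Relation.Binary.PropositionalEquality

-- Identities between fractions are proved in ℚᵘ, where the arithmetic of fractions is definitional.

/≡fromℚᵘ : ∀ i n .{{_ : NonZero n}} → i / n ≡ fromℚᵘ (i ℚᵘ./ n)
/≡fromℚᵘ i (suc n) = refl

toℚᵘ-/ : ∀ i n .{{_ : NonZero n}} → toℚᵘ (i / n) ℚᵘ.≃ (i ℚᵘ./ n)
toℚᵘ-/ i (suc n) = ℚP.toℚᵘ-fromℚᵘ (i ℚᵘ./ suc n)

via-ℚᵘ : ∀ {p q u} → toℚᵘ p ℚᵘ.≃ u → toℚᵘ q ℚᵘ.≃ u → p ≡ q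
via-ℚᵘ p≃u q≃u = ℚP.toℚᵘ-injective (ℚᵘP.≃-trans p≃u (ℚᵘP.≃-sym q≃u))

toℚᵘ-+ : ∀ p q {a b} → toℚᵘ p ℚᵘ.≃ a → toℚᵘ q ℚᵘ.≃ b → toℚᵘ (p + q) ℚᵘ.≃ (a ℚᵘ.+ b)
toℚᵘ-+ p q p≃a q≃b = ℚᵘP.≃-trans (ℚP.toℚᵘ-homo-+ p q) (ℚᵘP.+-cong p≃a q≃b)

toℚᵘ-* : ∀ p q {a b} → toℚᵘ p ℚᵘ.≃ a → toℚᵘ q ℚᵘ.≃ b → toℚᵘ (p * q) ℚᵘ.≃ (a ℚᵘ.* b)
toℚᵘ-* p q p≃a q≃b = ℚᵘP.≃-trans (ℚP.toℚᵘ-homo-* p q) (ℚᵘP.*-cong p≃a q≃b)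

/-+-/ : ∀ i j m n .{{_ : NonZero m}} .{{_ : NonZero n}} .{{_ : NonZero (m ℕ.* n)}} →
        i / m + j / n ≡ (i ℤ.* + n ℤ.+ j ℤ.* + m) / (m ℕ.* n)
/-+-/ i j (suc m) (suc n) =
  via-ℚᵘ (toℚᵘ-+ (i / suc m) (j / suc n) (toℚᵘ-/ i (suc m)) (toℚᵘ-/ j (suc n))) (toℚᵘ-/ _ (suc m ℕ.* suc n))

/-*-/ : ∀ i j m n .{{_ : NonZero m}} .{{_ : NonZero n}} .{{_ : NonZero (m ℕ.* n)}} →
        (i / m) * (j / n) ≡ (i ℤ.* j) / (m ℕ.* n)
/-*-/ i j (suc m) (suc n) =
  via-ℚᵘ (toℚᵘ-* (i / suc m) (j / suc n) (toℚᵘ-/ i (suc m)) (toℚᵘ-/ j (suc n))) (toℚᵘ-/ _ (suc m ℕ.* suc n))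

-‿/ : ∀ i n .{{_ : NonZero n}} → - (i / n) ≡ (ℤ.- i) / n
-‿/ i (suc n) = via-ℚᵘ
  (ℚᵘP.≃-trans (ℚP.toℚᵘ-homo‿- (i / suc n)) (ℚᵘP.-‿cong (toℚᵘ-/ i (suc n)))) (toℚᵘ-/ _ (suc n))

*-cancelʳ-/ : ∀ k i n .{{_ : NonZero n}} .{{_ : NonZero k}} .{{_ : NonZero (n ℕ.* k)}} →
              (i ℤ.* + k) / (n ℕ.* k) ≡ i / n
*-cancelʳ-/ k i n = begin
  (i ℤ.* + k) / (n ℕ.* k)             ≡⟨ /≡fromℚᵘ _ (n ℕ.* k) ⟩
  fromℚᵘ ((i ℤ.* + k) ℚᵘ./ (n ℕ.* k)) ≡⟨ ℚP.fromℚᵘ-cong (ℚᵘP.*-cancelʳ-/ k) ⟩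
  fromℚᵘ (i ℚᵘ./ n)                   ≡⟨ /≡fromℚᵘ i n ⟨
  i / n                               ∎
  where open ≡-Reasoning

/-congʳ : ∀ i {m n} .{{_ : NonZero m}} .{{_ : NonZero n}} → m ≡ n → i / m ≡ i / n
/-congʳ i refl = refl

↥/-cross : ∀ i n .{{_ : NonZero n}} → ↥ (i / n) ℤ.* + n ≡ i ℤ.* ↧ (i / n)
↥/-cross i (suc n) with toℚᵘ-/ i (suc n)
... | *≡* eq = trans (cong (ℤ._* + suc n) (sym (ℚP.↥ᵘ-toℚᵘ (i / suc n))))
                     (trans eq (cong (i ℤ.*_) (ℚP.↧ᵘ-toℚᵘ (i / suc n))))

cross⇒/< : ∀ i j m n .{{_ : NonZero m}} .{{_ : NonZero n}} → i ℤ.* + n ℤ.< j ℤ.* + m → i / m < j / n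
cross⇒/< i j (suc m) (suc n) lt = ℚP.toℚᵘ-cancel-<
  (ℚᵘP.<-respˡ-≃ (ℚᵘP.≃-sym (toℚᵘ-/ i (suc m))) (ℚᵘP.<-respʳ-≃ (ℚᵘP.≃-sym (toℚᵘ-/ j (suc n))) (*<* lt)))

/<⇒cross : ∀ i j m n .{{_ : NonZero m}} .{{_ : NonZero n}} → i / m < j / n → i ℤ.* + n ℤ.< j ℤ.* + m
/<⇒cross i j (suc m) (suc n) lt
  with ℚᵘP.<-respˡ-≃ (toℚᵘ-/ i (suc m)) (ℚᵘP.<-respʳ-≃ (toℚᵘ-/ j (suc n)) (ℚP.toℚᵘ-mono-< lt))
... | *<* cross = cross

cross⇒/≤ : ∀ i j m n .{{_ : NonZero m}} .{{_ : NonZero n}} → i ℤ.* + n ℤ.≤ j ℤ.* + m → i / m ≤ j / n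
cross⇒/≤ i j (suc m) (suc n) le = ℚP.toℚᵘ-cancel-≤
  (ℚᵘP.≤-respˡ-≃ (ℚᵘP.≃-sym (toℚᵘ-/ i (suc m))) (ℚᵘP.≤-respʳ-≃ (ℚᵘP.≃-sym (toℚᵘ-/ j (suc n))) (*≤* le)))

/-−-/ : ∀ i j m n s .{{_ : NonZero (m ℕ.* s)}} .{{_ : NonZero (n ℕ.* s)}} .{{_ : NonZero (m ℕ.* n ℕ.* s)}} →
        i / (m ℕ.* s) - j / (n ℕ.* s) ≡ (i ℤ.* + n ℤ.- j ℤ.* + m) / (m ℕ.* n ℕ.* s)
/-−-/ i j m n s = begin
  i / (m ℕ.* s) + - (j / (n ℕ.* s))
    ≡⟨ cong (_+_ (i / (m ℕ.* s))) (-‿/ j (n ℕ.* s)) ⟩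
  i / (m ℕ.* s) + (ℤ.- j) / (n ℕ.* s)
    ≡⟨ /-+-/ i (ℤ.- j) (m ℕ.* s) (n ℕ.* s) ⟩
  (i ℤ.* + (n ℕ.* s) ℤ.+ ℤ.- j ℤ.* + (m ℕ.* s)) / (m ℕ.* s ℕ.* (n ℕ.* s))
    ≡⟨ ℚP./-cong numerator (denominator m n s) ⟩
  ((i ℤ.* + n ℤ.- j ℤ.* + m) ℤ.* + s) / (m ℕ.* n ℕ.* s ℕ.* s)
    ≡⟨ *-cancelʳ-/ s (i ℤ.* + n ℤ.- j ℤ.* + m) (m ℕ.* n ℕ.* s) ⟩
  (i ℤ.* + n ℤ.- j ℤ.* + m) / (m ℕ.* n ℕ.* s) ∎
  where
  open ≡-Reasoning
  instance
    s≢0 : NonZero s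
    s≢0 = ℕP.m*n≢0⇒n≢0 m
    ms*ns≢0 : NonZero (m ℕ.* s ℕ.* (n ℕ.* s))
    ms*ns≢0 = ℕP.m*n≢0 (m ℕ.* s) (n ℕ.* s)
    mns*s≢0 : NonZero (m ℕ.* n ℕ.* s ℕ.* s)
    mns*s≢0 = ℕP.m*n≢0 (m ℕ.* n ℕ.* s) s
  numerator : i ℤ.* + (n ℕ.* s) ℤ.+ ℤ.- j ℤ.* + (m ℕ.* s) ≡ (i ℤ.* + n ℤ.- j ℤ.* + m) ℤ.* + s
  numerator = trans (cong₂ (λ u v → i ℤ.* u ℤ.+ ℤ.- j ℤ.* v) (ℤP.pos-* n s) (ℤP.pos-* m s))
                    (factor-out i j (+ n) (+ m) (+ s))
    where
    factor-out : ∀ i j n m s → i ℤ.* (n ℤ.* s) ℤ.+ ℤ.- j ℤ.* (m ℤ.* s) ≡ (i ℤ.* n ℤ.- j ℤ.* m) ℤ.* s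
    factor-out = solve-∀
  denominator : ∀ m n s → m ℕ.* s ℕ.* (n ℕ.* s) ≡ m ℕ.* n ℕ.* s ℕ.* s
  denominator = ℕ-Ring.solve-∀

normK-/ : ∀ d i j n .{{_ : NonZero n}} .{{_ : NonZero (n ℕ.* n)}} → normK d (i / n , j / n) ≡ (i ℤ.* i ℤ.+ + d ℤ.* (j ℤ.* j)) / (n ℕ.* n)
normK-/ d i j n = begin
  (i / n) * (i / n) + (+ d / 1) * ((j / n) * (j / n))
    ≡⟨ cong₂ (λ u v → u + (+ d / 1) * v) (/-*-/ i i n n) (/-*-/ j j n n) ⟩
  (i ℤ.* i) / n² + (+ d / 1) * ((j ℤ.* j) / n²)
    ≡⟨ cong (_+_ ((i ℤ.* i) / n²)) (/-*-/ (+ d) (j ℤ.* j) 1 n²) ⟩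
  (i ℤ.* i) / n² + (+ d ℤ.* (j ℤ.* j)) / (1 ℕ.* n²)
    ≡⟨ /-+-/ (i ℤ.* i) (+ d ℤ.* (j ℤ.* j)) n² (1 ℕ.* n²) ⟩
  (i ℤ.* i ℤ.* + (1 ℕ.* n²) ℤ.+ + d ℤ.* (j ℤ.* j) ℤ.* + n²) / (n² ℕ.* (1 ℕ.* n²))
    ≡⟨ ℚP./-cong numerator (cong (n² ℕ.*_) (ℕP.*-identityˡ n²)) ⟩
  ((i ℤ.* i ℤ.+ + d ℤ.* (j ℤ.* j)) ℤ.* + n²) / (n² ℕ.* n²)
    ≡⟨ *-cancelʳ-/ n² (i ℤ.* i ℤ.+ + d ℤ.* (j ℤ.* j)) n² ⟩
  (i ℤ.* i ℤ.+ + d ℤ.* (j ℤ.* j)) / n² ∎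
  where
  open ≡-Reasoning
  n² = n ℕ.* n
  instance
    1*n²≢0 : NonZero (1 ℕ.* n²)
    1*n²≢0 = ℕP.m*n≢0 1 n²
    n²*1n²≢0 : NonZero (n² ℕ.* (1 ℕ.* n²))
    n²*1n²≢0 = ℕP.m*n≢0 n² (1 ℕ.* n²)
    n²*n²≢0 : NonZero (n² ℕ.* n²)
    n²*n²≢0 = ℕP.m*n≢0 n² n²
  numerator : i ℤ.* i ℤ.* + (1 ℕ.* n²) ℤ.+ + d ℤ.* (j ℤ.* j) ℤ.* + n²
            ≡ (i ℤ.* i ℤ.+ + d ℤ.* (j ℤ.* j)) ℤ.* + n²
  numerator = trans (cong (λ u → i ℤ.* i ℤ.* + u ℤ.+ + d ℤ.* (j ℤ.* j) ℤ.* + n²) (ℕP.*-identityˡ n²))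
                    (sym (ℤP.*-distribʳ-+ (+ n²) (i ℤ.* i) (+ d ℤ.* (j ℤ.* j))))

-- S-free parts and the set T

SFree : List ℕ → ℕ → Set
SFree S r = ∀ p → p ∈ S → ¬ p ∣ r

InT-1 : ∀ S → InT S 1
InT-1 S = _ , λ q q-prime q∣1 → ⊥-elim (¬prime[1] (subst Prime (∣1⇒≡1 q∣1) q-prime))

InT-* : ∀ {S a b} → InT S a → InT S b → InT S (a ℕ.* b)
InT-* {S} {a} {b} (a≢0 , a∈T) (b≢0 , b∈T) =
  ℕP.m*n≢0 a b {{a≢0}} {{b≢0}} , λ q q-prime q∣ab → [_,_] (a∈T q q-prime) (b∈T q q-prime) (euclidsLemma a b q-prime q∣ab)

InT-∷ : ∀ {S p c} → InT S c → InT (p ∷ S) c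
InT-∷ (c≢0 , c∈T) = c≢0 , λ q q-prime q∣c → there (c∈T q q-prime q∣c)

prime∣p^e⇒≡p : ∀ {p q} e → Prime p → Prime q → q ∣ p ^ e → q ≡ p
prime∣p^e⇒≡p zero p-prime q-prime q∣1 = ⊥-elim (¬prime[1] (subst Prime (∣1⇒≡1 q∣1) q-prime))
prime∣p^e⇒≡p {p} {q} (suc e) p-prime q-prime q∣p^e+1 with euclidsLemma p (p ^ e) q-prime q∣p^e+1
... | inj₂ q∣p^e = prime∣p^e⇒≡p e p-prime q-prime q∣p^e
... | inj₁ q∣p with prime⇒irreducible p-prime q∣p
...   | inj₁ q≡1 = ⊥-elim (¬prime[1] (subst Prime q≡1 q-prime))
...   | inj₂ q≡p = q≡p

InT-^ : ∀ {S p} e → Prime p → InT (p ∷ S) (p ^ e)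
InT-^ {S} {p} e p-prime =
  ℕP.m^n≢0 p e {{prime⇒nonZero p-prime}} ,
  λ q q-prime q∣p^e → here (prime∣p^e⇒≡p e p-prime q-prime q∣p^e)

SFree-* : ∀ {S a b} → All Prime S → SFree S a → SFree S b → SFree S (a ℕ.* b)
SFree-* {S} {a} {b} S-prime a-free b-free p p∈S p∣ab =
  [_,_] (a-free p p∈S) (b-free p p∈S) (euclidsLemma a b (All.lookup S-prime p∈S) p∣ab)

divOut-factorisation : ∀ f k n .{{_ : NonZero n}} → n ℕ.≤ f →
  let p = suc (suc k) in (∃ λ e → n ≡ divOut f p n ℕ.* p ^ e) × ¬ p ∣ divOut f p n
divOut-factorisation zero k (suc n) ()
divOut-factorisation (suc f) k n n≤f with suc (suc k) ∣? n
... | no p∤n = (0 , sym (ℕP.*-identityʳ n)) , p∤n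
... | yes p∣n =
  let (e , n/p≡) , p∤ = divOut-factorisation f k (n div p) {{n/p≢0}} (ℕP.≤-pred (ℕP.≤-trans n/p<n n≤f))
  in (suc e , n≡ e n/p≡) , p∤
  where
  p = suc (suc k)
  n/p≢0 : NonZero (n div p)
  n/p≢0 = ℕ.>-nonZero (m≥n⇒m/n>0 (∣⇒≤ p∣n))
  n/p<n : n div p ℕ.< n
  n/p<n = m/n<m n p (ℕ.s≤s (ℕ.s≤s ℕ.z≤n))
  m = divOut f p (n div p)
  n≡ : ∀ e → n div p ≡ m ℕ.* p ^ e → n ≡ m ℕ.* (p ℕ.* p ^ e)
  n≡ e n/p≡ = begin
    n                   ≡⟨ m/n*n≡m p∣n ⟨
    n div p ℕ.* p       ≡⟨ cong (ℕ._* p) n/p≡ ⟩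
    m ℕ.* p ^ e ℕ.* p   ≡⟨ ℕP.*-assoc m (p ^ e) p ⟩
    m ℕ.* (p ^ e ℕ.* p) ≡⟨ cong (m ℕ.*_) (ℕP.*-comm (p ^ e) p) ⟩
    m ℕ.* (p ℕ.* p ^ e) ∎
    where open ≡-Reasoning

removeS-factorisation : ∀ S → All Prime S → ∀ n → NonZero n →
  ∃ λ t → InT S t × n ≡ removeS S n ℕ.* t × SFree S (removeS S n)
removeS-factorisation [] _ n _ = 1 , InT-1 [] , sym (ℕP.*-identityʳ n) , λ _ ()
removeS-factorisation (zero ∷ S) (0-prime ∷ _) = ⊥-elim (¬prime[0] 0-prime)
removeS-factorisation (1 ∷ S) (1-prime ∷ _) = ⊥-elim (¬prime[1] 1-prime)
removeS-factorisation (suc (suc k) ∷ S) (p-prime ∷ S-prime) n n≢0 =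
  let (e , n≡m*p^e) , p∤m = divOut-factorisation n k n {{n≢0}} ℕP.≤-refl
      t , t∈T , m≡r*t , r-free = removeS-factorisation S S-prime m (divOut-nz n p n n≢0)
  in t ℕ.* p ^ e , InT-* (InT-∷ t∈T) (InT-^ e p-prime) , n≡ e t n≡m*p^e m≡r*t , free-of-p t p∤m m≡r*t r-free
  where
  p = suc (suc k)
  m = divOut n p n
  r = removeS S m
  n≡ : ∀ e t → n ≡ m ℕ.* p ^ e → m ≡ r ℕ.* t → n ≡ r ℕ.* (t ℕ.* p ^ e)
  n≡ e t n≡m*p^e m≡r*t = begin
    n                   ≡⟨ n≡m*p^e ⟩
    m ℕ.* p ^ e         ≡⟨ cong (ℕ._* p ^ e) m≡r*t ⟩
    r ℕ.* t ℕ.* p ^ e   ≡⟨ ℕP.*-assoc r t (p ^ e) ⟩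
    r ℕ.* (t ℕ.* p ^ e) ∎
    where open ≡-Reasoning
  free-of-p : ∀ t → ¬ p ∣ m → m ≡ r ℕ.* t → SFree S r → SFree (p ∷ S) r
  free-of-p t p∤m m≡r*t r-free q (here refl) q∣r = p∤m (∣-trans q∣r (divides t (trans m≡r*t (ℕP.*-comm r t))))
  free-of-p t p∤m m≡r*t r-free q (there q∈S) q∣r = r-free q q∈S q∣r

prime-divisor : ∀ n .{{_ : NonZero n}} → n ≢ 1 → ∃ λ p → Prime p × p ∣ n
prime-divisor n n≢1 with factorise n
... | record { factors = [] ; isFactorisation = n≡1 } = ⊥-elim (n≢1 n≡1)
... | record { factors = p ∷ ps ; isFactorisation = n≡ ; factorsPrime = p-prime ∷ _ } =
  p , p-prime , subst (p ∣_) (sym n≡) (m∣m*n _)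

SFree⇒coprime-InT : ∀ {S r t} → NonZero r → SFree S r → InT S t → Coprime r t
SFree⇒coprime-InT {r = r} r≢0 _ _ {zero} (0∣r , _) =
  ⊥-elim (ℕ.≢-nonZero⁻¹ r {{r≢0}} (0∣⇒≡0 0∣r))
SFree⇒coprime-InT r≢0 r-free (_ , t∈T) {suc i} (i∣r , i∣t) with suc i ℕ.≟ 1
... | yes i≡1 = i≡1
... | no i≢1 with prime-divisor (suc i) i≢1
...   | p , p-prime , p∣i = ⊥-elim (r-free p (t∈T p p-prime (∣-trans p∣i i∣t)) (∣-trans p∣i i∣r))

SFree*InT-unique : ∀ {S r r′ t t′} → NonZero r → NonZero r′ → SFree S r → SFree S r′ → InT S t → InT S t′ →
  r ℕ.* t ≡ r′ ℕ.* t′ → r ≡ r′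
SFree*InT-unique {S} {r} {r′} {t} {t′} r≢0 r′≢0 r-free r′-free t∈T t′∈T rt≡r′t′ = ∣-antisym r∣r′ r′∣r
  where
  r∣r′ : r ∣ r′
  r∣r′ = coprime-divisor (SFree⇒coprime-InT r≢0 r-free t′∈T)
           (divides t (trans (ℕP.*-comm t′ r′) (trans (sym rt≡r′t′) (ℕP.*-comm r t))))
  r′∣r : r′ ∣ r
  r′∣r = coprime-divisor (SFree⇒coprime-InT r′≢0 r′-free t∈T)
           (divides t′ (trans (ℕP.*-comm t r) (trans rt≡r′t′ (ℕP.*-comm r′ t′))))

removeS-SFree*InT : ∀ {S r t} → All Prime S → NonZero r → SFree S r → InT S t → removeS S (r ℕ.* t) ≡ r
removeS-SFree*InT {S} {r} {t} S-prime r≢0 r-free t∈T =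
  let t′ , t′∈T , rt≡ , rt-free = removeS-factorisation S S-prime (r ℕ.* t) rt≢0
  in SFree*InT-unique (removeS-nz S (r ℕ.* t) rt≢0) r≢0 rt-free r-free t′∈T t∈T (sym rt≡)
  where rt≢0 = ℕP.m*n≢0 r t {{r≢0}} {{proj₁ t∈T}}

removeS-* : ∀ {S} → All Prime S → ∀ a b → NonZero a → NonZero b →
  removeS S (a ℕ.* b) ≡ removeS S a ℕ.* removeS S b
removeS-* {S} S-prime a b a≢0 b≢0 =
  let ta , ta∈T , a≡ , a-free = removeS-factorisation S S-prime a a≢0
      tb , tb∈T , b≡ , b-free = removeS-factorisation S S-prime b b≢0
      ra = removeS S a
      rb = removeS S b
  in begin
  removeS S (a ℕ.* b)                   ≡⟨ cong (removeS S) (cong₂ ℕ._*_ a≡ b≡) ⟩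
  removeS S ((ra ℕ.* ta) ℕ.* (rb ℕ.* tb)) ≡⟨ cong (removeS S) (*-interchange ra ta rb tb) ⟩
  removeS S ((ra ℕ.* rb) ℕ.* (ta ℕ.* tb)) ≡⟨ removeS-SFree*InT S-prime (ℕP.m*n≢0 ra rb {{removeS-nz S a a≢0}} {{removeS-nz S b b≢0}})
                                               (SFree-* S-prime a-free b-free) (InT-* ta∈T tb∈T) ⟩
  ra ℕ.* rb                             ∎
  where open ≡-Reasoning

removeS-≤ : ∀ {S} → All Prime S → ∀ n → NonZero n → removeS S n ℕ.≤ n
removeS-≤ {S} S-prime n n≢0 =
  let t , _ , n≡ , _ = removeS-factorisation S S-prime n n≢0
  in ∣⇒≤ {{n≢0}} (divides t (trans n≡ (ℕP.*-comm (removeS S n) t)))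

removeS-0 : ∀ S → removeS S 0 ≡ 0
removeS-0 [] = refl
removeS-0 (p ∷ S) = removeS-0 S

removeS-< : ∀ {S m t} → All Prime S → SFree S m → InT S t → ∀ {n u v} → n ℕ.< m → NonZero v →
  u ℕ.* (m ℕ.* t) ≡ n ℕ.* v → removeS S u ℕ.< removeS S v
removeS-< {S} {m} {t} S-prime m-free t∈T {zero} {u} {v} n<m v≢0 u*mt≡0 =
  subst (ℕ._< removeS S v) (sym (trans (cong (removeS S) u≡0) (removeS-0 S)))
        (ℕ.>-nonZero⁻¹ (removeS S v) {{removeS-nz S v v≢0}})
  where
  u≡0 : u ≡ 0
  u≡0 = ℕP.m*n≡0⇒m≡0 u (m ℕ.* t) {{ℕP.m*n≢0 m t {{ℕ.>-nonZero n<m}} {{proj₁ t∈T}}}} u*mt≡0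
removeS-< {S} {m} {t} S-prime m-free t∈T {n@(suc _)} {u} {v} n<m v≢0 u*mt≡n*v =
  ℕP.*-cancelʳ-< m (removeS S u) (removeS S v) (begin-strict
    removeS S u ℕ.* m                 ≡⟨ cong (removeS S u ℕ.*_) (removeS-SFree*InT S-prime m≢0 m-free t∈T) ⟨
    removeS S u ℕ.* removeS S (m ℕ.* t) ≡⟨ removeS-* S-prime u (m ℕ.* t) u≢0 mt≢0 ⟨
    removeS S (u ℕ.* (m ℕ.* t))       ≡⟨ cong (removeS S) u*mt≡n*v ⟩
    removeS S (n ℕ.* v)               ≡⟨ removeS-* S-prime n v _ v≢0 ⟩
    removeS S n ℕ.* removeS S v       ≤⟨ ℕP.*-monoˡ-≤ (removeS S v) (removeS-≤ S-prime n _) ⟩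
    n ℕ.* removeS S v                 <⟨ ℕP.*-monoˡ-< (removeS S v) {{removeS-nz S v v≢0}} n<m ⟩
    m ℕ.* removeS S v                 ≡⟨ ℕP.*-comm m (removeS S v) ⟩
    removeS S v ℕ.* m                 ∎)
  where
  open ℕP.≤-Reasoning
  m≢0 : NonZero m
  m≢0 = ℕ.>-nonZero (ℕP.≤-<-trans ℕ.z≤n n<m)
  mt≢0 : NonZero (m ℕ.* t)
  mt≢0 = ℕP.m*n≢0 m t {{m≢0}} {{proj₁ t∈T}}
  u≢0 : NonZero u
  u≢0 = ℕ.≢-nonZero λ u≡0 → ℕ.≢-nonZero⁻¹ (n ℕ.* v) {{ℕP.m*n≢0 n v {{_}} {{v≢0}}}}
          (trans (sym u*mt≡n*v) (cong (ℕ._* (m ℕ.* t)) u≡0))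

NS-/<1 : ∀ {S m t} → All Prime S → SFree S m → InT S t → ∀ n → n ℕ.< m → .{{_ : NonZero (m ℕ.* t)}} →
  NS S ((+ n) / (m ℕ.* t)) < 1ℚ
NS-/<1 {S} {m} {t} S-prime m-free t∈T n n<m =
  cross⇒/< (+ removeS S u) (+ 1) (removeS S v) 1 {{removeS-nz S v v≢0}}
    (subst₂ ℤ._<_ (sym (ℤP.*-identityʳ _)) (sym (ℤP.*-identityˡ _)) (ℤ.+<+ (removeS-< S-prime m-free t∈T n<m v≢0 cross)))
  where
  q = (+ n) / (m ℕ.* t)
  u = ∣ ↥ q ∣
  v = ↧ₙ q
  v≢0 : NonZero v
  v≢0 = _
  cross : u ℕ.* (m ℕ.* t) ≡ n ℕ.* v
  cross = trans (sym (ℤP.abs-* (↥ q) (+ (m ℕ.* t)))) (trans (cong ∣_∣ (↥/-cross (+ n) (m ℕ.* t))) (ℤP.abs-* (+ n) (↧ q)))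

-- Rational approximation

FracHypothesis : ℕ → List ℕ → Set
FracHypothesis D S = ∀ (y : ℚ) → 0ℚ ≤ y → y ≤ 1ℚ → Σ ℕ λ c → Σ (InT S c) λ _ → FracCondition D ((+ c / 1) * y)

FracCondition⇒near-integer : ∀ D t → FracCondition D t → ∃ λ b → (t - b / 1) * (t - b / 1) * (+ D / 1) < + 3 / 1
FracCondition⇒near-integer D t (inj₁ frac-small) = floor t , frac-small
FracCondition⇒near-integer D t (inj₂ frac-large) =
  floor t ℤ.+ + 1 , subst (λ u → u * (+ D / 1) < + 3 / 1) square≡ frac-large
  where
  open +-*-Solver
  ⌊t⌋ = floor t / 1
  ⌊t⌋+1≡ : ⌊t⌋ + 1ℚ ≡ (floor t ℤ.+ + 1) / 1
  ⌊t⌋+1≡ = trans (/-+-/ (floor t) (+ 1) 1 1) (ℚP./-cong (cong₂ ℤ._+_ (ℤP.*-identityʳ (floor t)) refl) refl)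
  square≡ : (1ℚ - (t - ⌊t⌋)) * (1ℚ - (t - ⌊t⌋)) ≡ (t - (floor t ℤ.+ + 1) / 1) * (t - (floor t ℤ.+ + 1) / 1)
  square≡ = trans (solve 2 (λ t f → (con 1ℚ :- (t :- f)) :* (con 1ℚ :- (t :- f)) := (t :- (f :+ con 1ℚ)) :* (t :- (f :+ con 1ℚ))) refl t ⌊t⌋)
                  (cong (λ u → (t - u) * (t - u)) ⌊t⌋+1≡)

i*i≡∣i∣*∣i∣ : ∀ i → i ℤ.* i ≡ + (∣ i ∣ ℕ.* ∣ i ∣)
i*i≡∣i∣*∣i∣ (+ n) = sym (ℤP.pos-* n n)
i*i≡∣i∣*∣i∣ -[1+ n ] = refl

/-−-/1 : ∀ i b n .{{_ : NonZero n}} → i / n - b / 1 ≡ (i ℤ.- b ℤ.* + n) / n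
/-−-/1 i b n = begin
  i / n + - (b / 1)                            ≡⟨ cong (_+_ (i / n)) (-‿/ b 1) ⟩
  i / n + (ℤ.- b) / 1                          ≡⟨ /-+-/ i (ℤ.- b) n 1 ⟩
  (i ℤ.* + 1 ℤ.+ ℤ.- b ℤ.* + n) / (n ℕ.* 1)    ≡⟨ ℚP./-cong numerator (ℕP.*-identityʳ n) ⟩
  (i ℤ.- b ℤ.* + n) / n                        ∎
  where
  open ≡-Reasoning
  instance
    n*1≢0 : NonZero (n ℕ.* 1)
    n*1≢0 = ℕP.m*n≢0 n 1
  numerator : i ℤ.* + 1 ℤ.+ ℤ.- b ℤ.* + n ≡ i ℤ.- b ℤ.* + n
  numerator = cong₂ ℤ._+_ (ℤP.*-identityʳ i) (sym (ℤP.neg-distribˡ-* b (+ n)))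

square-/<⇒ : ∀ B n D .{{_ : NonZero n}} → (B / n) * (B / n) * (+ D / 1) < + 3 / 1 →
  ∣ B ∣ ℕ.* ∣ B ∣ ℕ.* D ℕ.< 3 ℕ.* (n ℕ.* n)
square-/<⇒ B n D lt = ℤP.drop‿+<+ (subst₂ ℤ._<_ lhs≡ rhs≡ (/<⇒cross (B ℤ.* B ℤ.* + D) (+ 3) (n ℕ.* n ℕ.* 1) 1 lt′))
  where
  instance
    n*n≢0 : NonZero (n ℕ.* n)
    n*n≢0 = ℕP.m*n≢0 n n
    n*n*1≢0 : NonZero (n ℕ.* n ℕ.* 1)
    n*n*1≢0 = ℕP.m*n≢0 (n ℕ.* n) 1
  lt′ : (B ℤ.* B ℤ.* + D) / (n ℕ.* n ℕ.* 1) < + 3 / 1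
  lt′ = subst (_< + 3 / 1) (trans (cong (_* (+ D / 1)) (/-*-/ B B n n)) (/-*-/ (B ℤ.* B) (+ D) (n ℕ.* n) 1)) lt
  lhs≡ : B ℤ.* B ℤ.* + D ℤ.* + 1 ≡ + (∣ B ∣ ℕ.* ∣ B ∣ ℕ.* D)
  lhs≡ = trans (ℤP.*-identityʳ _) (trans (cong (ℤ._* + D) (i*i≡∣i∣*∣i∣ B)) (sym (ℤP.pos-* (∣ B ∣ ℕ.* ∣ B ∣) D)))
  rhs≡ : + 3 ℤ.* + (n ℕ.* n ℕ.* 1) ≡ + (3 ℕ.* (n ℕ.* n))
  rhs≡ = trans (sym (ℤP.pos-* 3 (n ℕ.* n ℕ.* 1))) (cong (λ k → + (3 ℕ.* k)) (ℕP.*-identityʳ (n ℕ.* n)))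

FracCondition-/ : ∀ D i n .{{_ : NonZero n}} → FracCondition D (i / n) →
  ∃ λ b → ∣ i ℤ.- b ℤ.* + n ∣ ℕ.* ∣ i ℤ.- b ℤ.* + n ∣ ℕ.* D ℕ.< 3 ℕ.* (n ℕ.* n)
FracCondition-/ D i n condition =
  let b , near = FracCondition⇒near-integer D (i / n) condition
  in b , square-/<⇒ (i ℤ.- b ℤ.* + n) n D (subst (λ u → u * u * (+ D / 1) < + 3 / 1) (/-−-/1 i b n) near)

InT-approximation : ∀ {D S} → FracHypothesis D S → ∀ W r .{{_ : NonZero r}} →
  ∃₂ λ c b → InT S c × ∣ W ℤ.* + c ℤ.- b ℤ.* + r ∣ ℕ.* ∣ W ℤ.* + c ℤ.- b ℤ.* + r ∣ ℕ.* D ℕ.< 3 ℕ.* (r ℕ.* r)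
InT-approximation {D} {S} hyp W r =
  let c , c∈T , condition = hyp (+ e / r) 0≤e/r e/r≤1
      b , bound = FracCondition-/ D (+ c ℤ.* + e) r (subst (FracCondition D) (c*e/r≡ c) condition)
  in c , b ℤ.+ + c ℤ.* q , c∈T ,
     subst (λ B → ∣ B ∣ ℕ.* ∣ B ∣ ℕ.* D ℕ.< 3 ℕ.* (r ℕ.* r))
           (trans (regroup (+ c) (+ e) b q (+ r)) (cong (λ w → w ℤ.* + c ℤ.- (b ℤ.+ + c ℤ.* q) ℤ.* + r) (sym W≡)))
           bound
  where
  e = W ℤ.%ℕ r
  q = W ℤ./ℕ r
  W≡ : W ≡ + e ℤ.+ q ℤ.* + r
  W≡ = a≡a%ℕn+[a/ℕn]*n W r
  0≤e/r : 0ℚ ≤ + e / r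
  0≤e/r = cross⇒/≤ (+ 0) (+ e) 1 r
    (subst₂ ℤ._≤_ (sym (ℤP.*-zeroˡ (+ r))) (sym (ℤP.*-identityʳ (+ e))) (ℤ.+≤+ ℕ.z≤n))
  e/r≤1 : + e / r ≤ 1ℚ
  e/r≤1 = cross⇒/≤ (+ e) (+ 1) r 1
    (subst₂ ℤ._≤_ (sym (ℤP.*-identityʳ (+ e))) (sym (ℤP.*-identityˡ (+ r))) (ℤ.+≤+ (ℕP.<⇒≤ (n%ℕd<d W r))))
  instance
    1*r≢0 : NonZero (1 ℕ.* r)
    1*r≢0 = ℕP.m*n≢0 1 r
  c*e/r≡ : ∀ c → (+ c / 1) * (+ e / r) ≡ (+ c ℤ.* + e) / r
  c*e/r≡ c = trans (/-*-/ (+ c) (+ e) 1 r) (/-congʳ (+ c ℤ.* + e) (ℕP.*-identityˡ r))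
  regroup : ∀ c e b q r → c ℤ.* e ℤ.- b ℤ.* r ≡ (e ℤ.+ q ℤ.* r) ℤ.* c ℤ.- (b ℤ.+ c ℤ.* q) ℤ.* r
  regroup = solve-∀

∣ρ⊖m∣≤m : ∀ ρ m → ρ ℕ.≤ m ℕ.+ m → ∣ ρ ⊖ m ∣ ℕ.≤ m
∣ρ⊖m∣≤m ρ m ρ≤2m with ℕP.≤-total m ρ
... | inj₁ m≤ρ rewrite ℤP.⊖-≥ m≤ρ =
  ℕP.+-cancelʳ-≤ m (ρ ℕ.∸ m) m (subst (ℕ._≤ m ℕ.+ m) (sym (ℕP.m∸n+n≡m m≤ρ)) ρ≤2m)
... | inj₂ ρ≤m rewrite ℤP.⊖-≤ ρ≤m | ℤP.∣-i∣≡∣i∣ (+ (m ℕ.∸ ρ)) = ℕP.m∸n≤m m ρ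

nearest-multiple : ∀ V m .{{_ : NonZero m}} → ∃ λ a → 2 ℕ.* ∣ V ℤ.- a ℤ.* + m ∣ ℕ.≤ m
-- a is the quotient of 2V + m by 2m, so that 2 (V − a m) = ρ − m with 0 ≤ ρ < 2m.
nearest-multiple V m = a , subst (ℕ._≤ m) ∣ρ⊖m∣≡ (∣ρ⊖m∣≤m ρ m (ℕP.<⇒≤ (n%ℕd<d W (m ℕ.+ m))))
  where
  instance
    2m≢0 : NonZero (m ℕ.+ m)
    2m≢0 = ℕ.>-nonZero (ℕP.≤-trans (ℕ.>-nonZero⁻¹ m) (ℕP.m≤m+n m m))
  W = + 2 ℤ.* V ℤ.+ + m
  ρ = W ℤ.%ℕ (m ℕ.+ m)
  a = W ℤ./ℕ (m ℕ.+ m)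
  2[V-am]≡ρ-m : + 2 ℤ.* (V ℤ.- a ℤ.* + m) ≡ + ρ ℤ.- + m
  2[V-am]≡ρ-m = begin
    + 2 ℤ.* (V ℤ.- a ℤ.* + m)                            ≡⟨ expand V a (+ m) ⟩
    W ℤ.- + m ℤ.- a ℤ.* (+ m ℤ.+ + m)                    ≡⟨ cong (λ w → w ℤ.- + m ℤ.- a ℤ.* (+ m ℤ.+ + m)) W≡ ⟩
    + ρ ℤ.+ a ℤ.* + (m ℕ.+ m) ℤ.- + m ℤ.- a ℤ.* (+ m ℤ.+ + m)
      ≡⟨ cong (λ k → + ρ ℤ.+ a ℤ.* k ℤ.- + m ℤ.- a ℤ.* (+ m ℤ.+ + m)) (ℤP.pos-+ m m) ⟩
    + ρ ℤ.+ a ℤ.* (+ m ℤ.+ + m) ℤ.- + m ℤ.- a ℤ.* (+ m ℤ.+ + m) ≡⟨ cancel (+ ρ) a (+ m) ⟩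
    + ρ ℤ.- + m                                          ∎
    where
    open ≡-Reasoning
    W≡ : W ≡ + ρ ℤ.+ a ℤ.* + (m ℕ.+ m)
    W≡ = a≡a%ℕn+[a/ℕn]*n W (m ℕ.+ m)
    expand : ∀ V a m → + 2 ℤ.* (V ℤ.- a ℤ.* m) ≡ + 2 ℤ.* V ℤ.+ m ℤ.- m ℤ.- a ℤ.* (m ℤ.+ m)
    expand = solve-∀
    cancel : ∀ ρ a m → ρ ℤ.+ a ℤ.* (m ℤ.+ m) ℤ.- m ℤ.- a ℤ.* (m ℤ.+ m) ≡ ρ ℤ.- m
    cancel = solve-∀
  ∣ρ⊖m∣≡ : ∣ ρ ⊖ m ∣ ≡ 2 ℕ.* ∣ V ℤ.- a ℤ.* + m ∣
  ∣ρ⊖m∣≡ = begin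
    ∣ ρ ⊖ m ∣                        ≡⟨ cong ∣_∣ (ℤP.m-n≡m⊖n ρ m) ⟨
    ∣ + ρ ℤ.- + m ∣                  ≡⟨ cong ∣_∣ 2[V-am]≡ρ-m ⟨
    ∣ + 2 ℤ.* (V ℤ.- a ℤ.* + m) ∣    ≡⟨ ℤP.abs-* (+ 2) (V ℤ.- a ℤ.* + m) ⟩
    2 ℕ.* ∣ V ℤ.- a ℤ.* + m ∣        ∎
    where open ≡-Reasoning

nearest-odd-multiple : ∀ V b r .{{_ : NonZero r}} → ∃ λ a → ∣ V ℤ.- (+ 2 ℤ.* a ℤ.+ b) ℤ.* + r ∣ ℕ.≤ r
nearest-odd-multiple V b r =
  let a , bound = nearest-multiple (V ℤ.- b ℤ.* + r) (2 ℕ.* r) {{ℕP.m*n≢0 2 r}}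
  in a , ℕP.*-cancelˡ-≤ 2 (subst (λ A → 2 ℕ.* ∣ A ∣ ℕ.≤ 2 ℕ.* r) (regroup′ a) bound)
  where
  regroup : ∀ V b r a → V ℤ.- b ℤ.* r ℤ.- a ℤ.* (+ 2 ℤ.* r) ≡ V ℤ.- (+ 2 ℤ.* a ℤ.+ b) ℤ.* r
  regroup = solve-∀
  regroup′ : ∀ a → V ℤ.- b ℤ.* + r ℤ.- a ℤ.* + (2 ℕ.* r) ≡ V ℤ.- (+ 2 ℤ.* a ℤ.+ b) ℤ.* + r
  regroup′ a = trans (cong (λ u → V ℤ.- b ℤ.* + r ℤ.- a ℤ.* u) (ℤP.pos-* 2 r)) (regroup V b (+ r) a)

-- The ring O_S and the norm form

mkOS-≢3 : ∀ d a b c .{{_ : NonZero c}} → ¬ MinusDOneMod4 d → mkOS d a b c ≡ (a / c , b / c)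
mkOS-≢3 d a b c d≢3 with d ℕ.% 4 ℕ.≟ 3
... | yes d≡3 = ⊥-elim (d≢3 d≡3)
... | no _ = refl

mkOS-≡3 : ∀ d a b c .{{_ : NonZero c}} .{{_ : NonZero (2 ℕ.* c)}} → MinusDOneMod4 d →
  mkOS d a b c ≡ ((+ 2 ℤ.* a ℤ.+ b) / (2 ℕ.* c) , b / (2 ℕ.* c))
mkOS-≡3 d a b c d≡3 with d ℕ.% 4 ℕ.≟ 3
... | no d≢3 = ⊥-elim (d≢3 d≡3)
... | yes _ = cong₂ _,_
  (begin
    (a / 1 + b / 2) * (+ 1 / c)                          ≡⟨ cong (_* (+ 1 / c)) (/-+-/ a b 1 2) ⟩
    ((a ℤ.* + 2 ℤ.+ b ℤ.* + 1) / 2) * (+ 1 / c)          ≡⟨ /-*-/ (a ℤ.* + 2 ℤ.+ b ℤ.* + 1) (+ 1) 2 c ⟩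
    ((a ℤ.* + 2 ℤ.+ b ℤ.* + 1) ℤ.* + 1) / (2 ℕ.* c)      ≡⟨ ℚP./-cong (regroup a b) refl ⟩
    (+ 2 ℤ.* a ℤ.+ b) / (2 ℕ.* c)                        ∎)
  (trans (/-*-/ b (+ 1) 2 c) (ℚP./-cong (ℤP.*-identityʳ b) refl))
  where
  open ≡-Reasoning
  regroup : ∀ a b → (a ℤ.* + 2 ℤ.+ b ℤ.* + 1) ℤ.* + 1 ≡ + 2 ℤ.* a ℤ.+ b
  regroup = solve-∀

discD-≢3 : ∀ d → ¬ MinusDOneMod4 d → discD d ≡ 4 ℕ.* d
discD-≢3 d d≢3 with d ℕ.% 4 ℕ.≟ 3
... | yes d≡3 = ⊥-elim (d≢3 d≡3)
... | no _ = refl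

discD-≡3 : ∀ d → MinusDOneMod4 d → discD d ≡ d
discD-≡3 d d≡3 with d ℕ.% 4 ℕ.≟ 3
... | no d≢3 = ⊥-elim (d≢3 d≡3)
... | yes _ = refl

quadratic-form≡ : ∀ d A B → A ℤ.* A ℤ.+ + d ℤ.* (B ℤ.* B) ≡ + (∣ A ∣ ℕ.* ∣ A ∣ ℕ.+ d ℕ.* (∣ B ∣ ℕ.* ∣ B ∣))
quadratic-form≡ d A B = begin
  A ℤ.* A ℤ.+ + d ℤ.* (B ℤ.* B)                       ≡⟨ cong₂ (λ u v → u ℤ.+ + d ℤ.* v) (i*i≡∣i∣*∣i∣ A) (i*i≡∣i∣*∣i∣ B) ⟩
  + (∣ A ∣ ℕ.* ∣ A ∣) ℤ.+ + d ℤ.* + (∣ B ∣ ℕ.* ∣ B ∣)  ≡⟨ cong (ℤ._+_ (+ (∣ A ∣ ℕ.* ∣ A ∣))) (ℤP.pos-* d _) ⟨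
  + (∣ A ∣ ℕ.* ∣ A ∣) ℤ.+ + (d ℕ.* (∣ B ∣ ℕ.* ∣ B ∣)) ≡⟨ ℤP.pos-+ (∣ A ∣ ℕ.* ∣ A ∣) _ ⟨
  + (∣ A ∣ ℕ.* ∣ A ∣ ℕ.+ d ℕ.* (∣ B ∣ ℕ.* ∣ B ∣))     ∎
  where open ≡-Reasoning

normK-−-/ : ∀ d X Y P Q m n s .{{_ : NonZero (m ℕ.* s)}} .{{_ : NonZero (n ℕ.* s)}} .{{_ : NonZero (m ℕ.* n ℕ.* s)}}
  .{{_ : NonZero (m ℕ.* n ℕ.* s ℕ.* (m ℕ.* n ℕ.* s))}} →
  let A = X ℤ.* + n ℤ.- P ℤ.* + m
      B = Y ℤ.* + n ℤ.- Q ℤ.* + m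
  in normK d ((X / (m ℕ.* s) , Y / (m ℕ.* s)) −K (P / (n ℕ.* s) , Q / (n ℕ.* s)))
     ≡ (+ (∣ A ∣ ℕ.* ∣ A ∣ ℕ.+ d ℕ.* (∣ B ∣ ℕ.* ∣ B ∣))) / (m ℕ.* n ℕ.* s ℕ.* (m ℕ.* n ℕ.* s))
normK-−-/ d X Y P Q m n s = begin
  normK d (X / (m ℕ.* s) - P / (n ℕ.* s) , Y / (m ℕ.* s) - Q / (n ℕ.* s))
    ≡⟨ cong₂ (λ u v → normK d (u , v)) (/-−-/ X P m n s) (/-−-/ Y Q m n s) ⟩
  normK d (A / (m ℕ.* n ℕ.* s) , B / (m ℕ.* n ℕ.* s))
    ≡⟨ normK-/ d A B (m ℕ.* n ℕ.* s) ⟩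
  (A ℤ.* A ℤ.+ + d ℤ.* (B ℤ.* B)) / (m ℕ.* n ℕ.* s ℕ.* (m ℕ.* n ℕ.* s))
    ≡⟨ ℚP./-cong (quadratic-form≡ d A B) refl ⟩
  (+ (∣ A ∣ ℕ.* ∣ A ∣ ℕ.+ d ℕ.* (∣ B ∣ ℕ.* ∣ B ∣))) / (m ℕ.* n ℕ.* s ℕ.* (m ℕ.* n ℕ.* s)) ∎
  where
  open ≡-Reasoning
  A = X ℤ.* + n ℤ.- P ℤ.* + m
  B = Y ℤ.* + n ℤ.- Q ℤ.* + m

normK-−-mkOS-≢3 : ∀ d → ¬ MinusDOneMod4 d → ∀ {r s c} .{{_ : NonZero (c ℕ.* s)}} .{{_ : NonZero r}} .{{_ : NonZero (r ℕ.* s)}} →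
  ∀ X Y a b .{{_ : NonZero (r ℕ.* r ℕ.* (c ℕ.* s ℕ.* (c ℕ.* s)))}} →
  let A = X ℤ.* + c ℤ.- a ℤ.* + r
      B = Y ℤ.* + c ℤ.- b ℤ.* + r
  in normK d ((X / (r ℕ.* s) , Y / (r ℕ.* s)) −K mkOS d a b (c ℕ.* s))
     ≡ (+ (∣ A ∣ ℕ.* ∣ A ∣ ℕ.+ d ℕ.* (∣ B ∣ ℕ.* ∣ B ∣))) / (r ℕ.* r ℕ.* (c ℕ.* s ℕ.* (c ℕ.* s)))
normK-−-mkOS-≢3 d d≢3 {r} {s} {c} X Y a b = begin
  normK d ((X / (r ℕ.* s) , Y / (r ℕ.* s)) −K mkOS d a b (c ℕ.* s))
    ≡⟨ cong (λ γ → normK d ((X / (r ℕ.* s) , Y / (r ℕ.* s)) −K γ)) (mkOS-≢3 d a b (c ℕ.* s) d≢3) ⟩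
  normK d ((X / (r ℕ.* s) , Y / (r ℕ.* s)) −K (a / (c ℕ.* s) , b / (c ℕ.* s)))
    ≡⟨ normK-−-/ d X Y a b r c s ⟩
  (+ n) / (r ℕ.* c ℕ.* s ℕ.* (r ℕ.* c ℕ.* s))
    ≡⟨ /-congʳ (+ n) (regroup r c s) ⟩
  (+ n) / (r ℕ.* r ℕ.* (c ℕ.* s ℕ.* (c ℕ.* s))) ∎
  where
  open ≡-Reasoning
  A = X ℤ.* + c ℤ.- a ℤ.* + r
  B = Y ℤ.* + c ℤ.- b ℤ.* + r
  n = ∣ A ∣ ℕ.* ∣ A ∣ ℕ.+ d ℕ.* (∣ B ∣ ℕ.* ∣ B ∣)
  instance
    c≢0 : NonZero c
    c≢0 = ℕP.m*n≢0⇒m≢0 c {s}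
    s≢0 : NonZero s
    s≢0 = ℕP.m*n≢0⇒n≢0 c {s}
    rcs≢0 : NonZero (r ℕ.* c ℕ.* s)
    rcs≢0 = ℕP.m*n≢0 (r ℕ.* c) s {{ℕP.m*n≢0 r c}}
    rcs²≢0 : NonZero (r ℕ.* c ℕ.* s ℕ.* (r ℕ.* c ℕ.* s))
    rcs²≢0 = ℕP.m*n≢0 (r ℕ.* c ℕ.* s) (r ℕ.* c ℕ.* s)
  regroup : ∀ r c s → r ℕ.* c ℕ.* s ℕ.* (r ℕ.* c ℕ.* s) ≡ r ℕ.* r ℕ.* (c ℕ.* s ℕ.* (c ℕ.* s))
  regroup = ℕ-Ring.solve-∀

normK-−-mkOS-≡3 : ∀ d → MinusDOneMod4 d → ∀ {r s c} .{{_ : NonZero (c ℕ.* s)}} .{{_ : NonZero r}} .{{_ : NonZero (r ℕ.* s)}} →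
  ∀ X Y a b .{{_ : NonZero (r ℕ.* r ℕ.* (c ℕ.* s ℕ.* (c ℕ.* s)) ℕ.* 4)}} →
  let A = X ℤ.* + (2 ℕ.* c) ℤ.- (+ 2 ℤ.* a ℤ.+ b) ℤ.* + r
      B = Y ℤ.* + (2 ℕ.* c) ℤ.- b ℤ.* + r
  in normK d ((X / (r ℕ.* s) , Y / (r ℕ.* s)) −K mkOS d a b (c ℕ.* s))
     ≡ (+ (∣ A ∣ ℕ.* ∣ A ∣ ℕ.+ d ℕ.* (∣ B ∣ ℕ.* ∣ B ∣))) / (r ℕ.* r ℕ.* (c ℕ.* s ℕ.* (c ℕ.* s)) ℕ.* 4)
normK-−-mkOS-≡3 d d≡3 {r} {s} {c} X Y a b = begin
  normK d ((X / (r ℕ.* s) , Y / (r ℕ.* s)) −K mkOS d a b (c ℕ.* s))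
    ≡⟨ cong (λ γ → normK d ((X / (r ℕ.* s) , Y / (r ℕ.* s)) −K γ)) (mkOS-≡3 d a b (c ℕ.* s) d≡3) ⟩
  normK d ((X / (r ℕ.* s) , Y / (r ℕ.* s)) −K ((+ 2 ℤ.* a ℤ.+ b) / (2 ℕ.* (c ℕ.* s)) , b / (2 ℕ.* (c ℕ.* s))))
    ≡⟨ cong₂ (λ u v → normK d ((X / (r ℕ.* s) , Y / (r ℕ.* s)) −K (u , v)))
             (/-congʳ (+ 2 ℤ.* a ℤ.+ b) (sym (ℕP.*-assoc 2 c s))) (/-congʳ b (sym (ℕP.*-assoc 2 c s))) ⟩
  normK d ((X / (r ℕ.* s) , Y / (r ℕ.* s)) −K ((+ 2 ℤ.* a ℤ.+ b) / (2 ℕ.* c ℕ.* s) , b / (2 ℕ.* c ℕ.* s)))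
    ≡⟨ normK-−-/ d X Y (+ 2 ℤ.* a ℤ.+ b) b r (2 ℕ.* c) s ⟩
  (+ n) / (r ℕ.* (2 ℕ.* c) ℕ.* s ℕ.* (r ℕ.* (2 ℕ.* c) ℕ.* s))
    ≡⟨ /-congʳ (+ n) (regroup r c s) ⟩
  (+ n) / (r ℕ.* r ℕ.* (c ℕ.* s ℕ.* (c ℕ.* s)) ℕ.* 4) ∎
  where
  open ≡-Reasoning
  A = X ℤ.* + (2 ℕ.* c) ℤ.- (+ 2 ℤ.* a ℤ.+ b) ℤ.* + r
  B = Y ℤ.* + (2 ℕ.* c) ℤ.- b ℤ.* + r
  n = ∣ A ∣ ℕ.* ∣ A ∣ ℕ.+ d ℕ.* (∣ B ∣ ℕ.* ∣ B ∣)
  instance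
    c≢0 : NonZero c
    c≢0 = ℕP.m*n≢0⇒m≢0 c {s}
    s≢0 : NonZero s
    s≢0 = ℕP.m*n≢0⇒n≢0 c {s}
    2c≢0 : NonZero (2 ℕ.* c)
    2c≢0 = ℕP.m*n≢0 2 c
    2[cs]≢0 : NonZero (2 ℕ.* (c ℕ.* s))
    2[cs]≢0 = ℕP.m*n≢0 2 (c ℕ.* s)
    2cs≢0 : NonZero (2 ℕ.* c ℕ.* s)
    2cs≢0 = ℕP.m*n≢0 (2 ℕ.* c) s
    r2cs≢0 : NonZero (r ℕ.* (2 ℕ.* c) ℕ.* s)
    r2cs≢0 = ℕP.m*n≢0 (r ℕ.* (2 ℕ.* c)) s {{ℕP.m*n≢0 r (2 ℕ.* c)}}
    r2cs²≢0 : NonZero (r ℕ.* (2 ℕ.* c) ℕ.* s ℕ.* (r ℕ.* (2 ℕ.* c) ℕ.* s))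
    r2cs²≢0 = ℕP.m*n≢0 (r ℕ.* (2 ℕ.* c) ℕ.* s) (r ℕ.* (2 ℕ.* c) ℕ.* s)
  regroup : ∀ r c s → r ℕ.* (2 ℕ.* c) ℕ.* s ℕ.* (r ℕ.* (2 ℕ.* c) ℕ.* s) ≡ r ℕ.* r ℕ.* (c ℕ.* s ℕ.* (c ℕ.* s)) ℕ.* 4
  regroup = ℕ-Ring.solve-∀

4∣quadratic-form : ∀ d → MinusDOneMod4 d → ∀ B κ →
  4 ∣ ∣ B ℤ.+ + 2 ℤ.* κ ∣ ℕ.* ∣ B ℤ.+ + 2 ℤ.* κ ∣ ℕ.+ d ℕ.* (∣ B ∣ ℕ.* ∣ B ∣)
4∣quadratic-form d d≡3 B κ = divides ∣ N ∣ (begin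
  ∣ + (∣ A ∣ ℕ.* ∣ A ∣ ℕ.+ d ℕ.* (∣ B ∣ ℕ.* ∣ B ∣)) ∣ ≡⟨ cong ∣_∣ (quadratic-form≡ d A B) ⟨
  ∣ A ℤ.* A ℤ.+ + d ℤ.* (B ℤ.* B) ∣                  ≡⟨ cong (λ δ → ∣ A ℤ.* A ℤ.+ δ ℤ.* (B ℤ.* B) ∣) +d≡ ⟩
  ∣ A ℤ.* A ℤ.+ (+ 3 ℤ.+ + k ℤ.* + 4) ℤ.* (B ℤ.* B) ∣ ≡⟨ cong ∣_∣ (expand B κ (+ k)) ⟩
  ∣ N ℤ.* + 4 ∣                                        ≡⟨ ℤP.abs-* N (+ 4) ⟩
  ∣ N ∣ ℕ.* 4                                          ∎)
  where
  open ≡-Reasoning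
  A = B ℤ.+ + 2 ℤ.* κ
  k = d div 4
  N = κ ℤ.* κ ℤ.+ κ ℤ.* B ℤ.+ (+ k ℤ.+ + 1) ℤ.* (B ℤ.* B)
  +d≡ : + d ≡ + 3 ℤ.+ + k ℤ.* + 4
  +d≡ = trans (cong +_ (trans (m≡m%n+[m/n]*n d 4) (cong (ℕ._+ k ℕ.* 4) d≡3)))
              (trans (ℤP.pos-+ 3 (k ℕ.* 4)) (cong (ℤ._+_ (+ 3)) (ℤP.pos-* k 4)))
  expand : ∀ B κ k → (B ℤ.+ + 2 ℤ.* κ) ℤ.* (B ℤ.+ + 2 ℤ.* κ) ℤ.+ (+ 3 ℤ.+ k ℤ.* + 4) ℤ.* (B ℤ.* B)
                   ≡ (κ ℤ.* κ ℤ.+ κ ℤ.* B ℤ.+ (k ℤ.+ + 1) ℤ.* (B ℤ.* B)) ℤ.* + 4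
  expand = solve-∀

≤∧<3*⇒+<4* : ∀ {α β m} → α ℕ.≤ m → β ℕ.< 3 ℕ.* m → α ℕ.+ β ℕ.< 4 ℕ.* m
≤∧<3*⇒+<4* {α} {β} {m} α≤m β<3m = subst (α ℕ.+ β ℕ.<_) (m+3m≡4m m) (ℕP.+-mono-≤-< α≤m β<3m)
  where
  m+3m≡4m : ∀ m → m ℕ.+ 3 ℕ.* m ≡ 4 ℕ.* m
  m+3m≡4m = ℕ-Ring.solve-∀

quadratic-form<-≢3 : ∀ d {r} A B → 2 ℕ.* ∣ A ∣ ℕ.≤ r → ∣ B ∣ ℕ.* ∣ B ∣ ℕ.* (4 ℕ.* d) ℕ.< 3 ℕ.* (r ℕ.* r) →
  ∣ A ∣ ℕ.* ∣ A ∣ ℕ.+ d ℕ.* (∣ B ∣ ℕ.* ∣ B ∣) ℕ.< r ℕ.* r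
quadratic-form<-≢3 d {r} A B A-bound B-bound =
  ℕP.*-cancelˡ-< 4 _ (r ℕ.* r) (subst (ℕ._< 4 ℕ.* (r ℕ.* r)) (sym (scale ∣ A ∣ ∣ B ∣ d))
    (≤∧<3*⇒+<4* (ℕP.*-mono-≤ A-bound A-bound) B-bound))
  where
  scale : ∀ α β d → 4 ℕ.* (α ℕ.* α ℕ.+ d ℕ.* (β ℕ.* β)) ≡ 2 ℕ.* α ℕ.* (2 ℕ.* α) ℕ.+ β ℕ.* β ℕ.* (4 ℕ.* d)
  scale = ℕ-Ring.solve-∀

quadratic-form-quarter-≡3 : ∀ d → MinusDOneMod4 d → ∀ {r} B κ → ∣ B ℤ.+ + 2 ℤ.* κ ∣ ℕ.≤ r →
  ∣ B ∣ ℕ.* ∣ B ∣ ℕ.* d ℕ.< 3 ℕ.* (r ℕ.* r) →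
  ∃ λ n′ → ∣ B ℤ.+ + 2 ℤ.* κ ∣ ℕ.* ∣ B ℤ.+ + 2 ℤ.* κ ∣ ℕ.+ d ℕ.* (∣ B ∣ ℕ.* ∣ B ∣) ≡ n′ ℕ.* 4 × n′ ℕ.< r ℕ.* r
quadratic-form-quarter-≡3 d d≡3 {r} B κ A-bound B-bound =
  let divides n′ N≡n′*4 = 4∣quadratic-form d d≡3 B κ
  in n′ , N≡n′*4 , ℕP.*-cancelʳ-< 4 n′ (r ℕ.* r) (subst₂ ℕ._<_ N≡n′*4 (ℕP.*-comm 4 (r ℕ.* r))
       (≤∧<3*⇒+<4* (ℕP.*-mono-≤ A-bound A-bound) (subst (ℕ._< 3 ℕ.* (r ℕ.* r)) (ℕP.*-comm _ d) B-bound)))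

-- Approximating ξ by an element of O_S

CloseToOS : ℕ → List ℕ → K → Set
CloseToOS d S ξ = Σ K λ γ → InOS d S γ × NS S (normK d (ξ −K γ)) < 1ℚ

NS-norm<1-≢3 : ∀ {d S} → All Prime S → ¬ MinusDOneMod4 d →
  ∀ {r s c} .{{_ : NonZero (c ℕ.* s)}} .{{_ : NonZero r}} .{{_ : NonZero (r ℕ.* s)}} → SFree S r → InT S s → InT S c →
  ∀ X Y a b → 2 ℕ.* ∣ X ℤ.* + c ℤ.- a ℤ.* + r ∣ ℕ.≤ r →
  ∣ Y ℤ.* + c ℤ.- b ℤ.* + r ∣ ℕ.* ∣ Y ℤ.* + c ℤ.- b ℤ.* + r ∣ ℕ.* (4 ℕ.* d) ℕ.< 3 ℕ.* (r ℕ.* r) →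
  NS S (normK d ((X / (r ℕ.* s) , Y / (r ℕ.* s)) −K mkOS d a b (c ℕ.* s))) < 1ℚ
NS-norm<1-≢3 {d} {S} S-prime d≢3 {r} {s} {c} r-free s∈T c∈T X Y a b A-bound B-bound =
  subst (λ q → NS S q < 1ℚ) (sym (normK-−-mkOS-≢3 d d≢3 {r} {s} {c} X Y a b))
    (NS-/<1 S-prime (SFree-* S-prime r-free r-free) (InT-* cs∈T cs∈T) n (quadratic-form<-≢3 d A B A-bound B-bound))
  where
  cs∈T = InT-* c∈T s∈T
  A = X ℤ.* + c ℤ.- a ℤ.* + r
  B = Y ℤ.* + c ℤ.- b ℤ.* + r
  n = ∣ A ∣ ℕ.* ∣ A ∣ ℕ.+ d ℕ.* (∣ B ∣ ℕ.* ∣ B ∣)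
  instance
    r²cs²≢0 : NonZero (r ℕ.* r ℕ.* (c ℕ.* s ℕ.* (c ℕ.* s)))
    r²cs²≢0 = ℕP.m*n≢0 (r ℕ.* r) (c ℕ.* s ℕ.* (c ℕ.* s)) {{ℕP.m*n≢0 r r}} {{ℕP.m*n≢0 (c ℕ.* s) (c ℕ.* s)}}

close-to-OS-≢3 : ∀ {d S} → All Prime S → ¬ MinusDOneMod4 d → FracHypothesis (discD d) S →
  ∀ {r s} .{{_ : NonZero r}} .{{_ : NonZero (r ℕ.* s)}} → SFree S r → InT S s →
  ∀ X Y → CloseToOS d S (X / (r ℕ.* s) , Y / (r ℕ.* s))
close-to-OS-≢3 {d} {S} S-prime d≢3 hyp {r} {s} r-free s∈T X Y =
  let c , b , c∈T , B-bound = InT-approximation {4 ℕ.* d} (subst (λ D → FracHypothesis D S) (discD-≢3 d d≢3) hyp) Y r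
      a , A-bound = nearest-multiple (X ℤ.* + c) r
      cs∈T = InT-* c∈T s∈T
  in mkOS d a b (c ℕ.* s) {{proj₁ cs∈T}} , (a , b , c ℕ.* s , cs∈T , refl) ,
     NS-norm<1-≢3 {d} S-prime d≢3 {{proj₁ cs∈T}} r-free s∈T c∈T X Y a b A-bound B-bound

NS-norm<1-≡3 : ∀ {d S} → All Prime S → MinusDOneMod4 d →
  ∀ {r s c} .{{_ : NonZero (c ℕ.* s)}} .{{_ : NonZero r}} .{{_ : NonZero (r ℕ.* s)}} → SFree S r → InT S s → InT S c →
  ∀ X Y a b → ∣ X ℤ.* + (2 ℕ.* c) ℤ.- (+ 2 ℤ.* a ℤ.+ b) ℤ.* + r ∣ ℕ.≤ r →
  ∣ Y ℤ.* + (2 ℕ.* c) ℤ.- b ℤ.* + r ∣ ℕ.* ∣ Y ℤ.* + (2 ℕ.* c) ℤ.- b ℤ.* + r ∣ ℕ.* d ℕ.< 3 ℕ.* (r ℕ.* r) →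
  NS S (normK d ((X / (r ℕ.* s) , Y / (r ℕ.* s)) −K mkOS d a b (c ℕ.* s))) < 1ℚ
NS-norm<1-≡3 {d} {S} S-prime d≡3 {r} {s} {c} r-free s∈T c∈T X Y a b A-bound B-bound =
  let n′ , N≡n′*4 , n′<r² = quadratic-form-quarter-≡3 d d≡3 B κ (subst (λ A → ∣ A ∣ ℕ.≤ r) A≡B+2κ A-bound) B-bound
  in subst (λ q → NS S q < 1ℚ) (sym (norm≡ n′ N≡n′*4))
       (NS-/<1 S-prime (SFree-* S-prime r-free r-free) (InT-* cs∈T cs∈T) n′ n′<r²)
  where
  cs∈T = InT-* c∈T s∈T
  R = r ℕ.* r ℕ.* (c ℕ.* s ℕ.* (c ℕ.* s))
  instance
    R≢0 : NonZero R
    R≢0 = ℕP.m*n≢0 (r ℕ.* r) (c ℕ.* s ℕ.* (c ℕ.* s)) {{ℕP.m*n≢0 r r}} {{ℕP.m*n≢0 (c ℕ.* s) (c ℕ.* s)}}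
    R*4≢0 : NonZero (R ℕ.* 4)
    R*4≢0 = ℕP.m*n≢0 R 4
  A = X ℤ.* + (2 ℕ.* c) ℤ.- (+ 2 ℤ.* a ℤ.+ b) ℤ.* + r
  B = Y ℤ.* + (2 ℕ.* c) ℤ.- b ℤ.* + r
  κ = X ℤ.* + c ℤ.- a ℤ.* + r ℤ.- Y ℤ.* + c
  A≡B+2κ : A ≡ B ℤ.+ + 2 ℤ.* κ
  A≡B+2κ = begin
    A                                                 ≡⟨ cong (λ u → X ℤ.* u ℤ.- (+ 2 ℤ.* a ℤ.+ b) ℤ.* + r) (ℤP.pos-* 2 c) ⟩
    X ℤ.* (+ 2 ℤ.* + c) ℤ.- (+ 2 ℤ.* a ℤ.+ b) ℤ.* + r  ≡⟨ regroup X (+ c) a b (+ r) Y ⟩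
    Y ℤ.* (+ 2 ℤ.* + c) ℤ.- b ℤ.* + r ℤ.+ + 2 ℤ.* κ   ≡⟨ cong (λ u → Y ℤ.* u ℤ.- b ℤ.* + r ℤ.+ + 2 ℤ.* κ) (ℤP.pos-* 2 c) ⟨
    B ℤ.+ + 2 ℤ.* κ                                   ∎
    where
    open ≡-Reasoning
    regroup : ∀ X c a b r Y → X ℤ.* (+ 2 ℤ.* c) ℤ.- (+ 2 ℤ.* a ℤ.+ b) ℤ.* r
                            ≡ Y ℤ.* (+ 2 ℤ.* c) ℤ.- b ℤ.* r ℤ.+ + 2 ℤ.* (X ℤ.* c ℤ.- a ℤ.* r ℤ.- Y ℤ.* c)
    regroup = solve-∀
  norm≡ : ∀ n′ → ∣ B ℤ.+ + 2 ℤ.* κ ∣ ℕ.* ∣ B ℤ.+ + 2 ℤ.* κ ∣ ℕ.+ d ℕ.* (∣ B ∣ ℕ.* ∣ B ∣) ≡ n′ ℕ.* 4 →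
    normK d ((X / (r ℕ.* s) , Y / (r ℕ.* s)) −K mkOS d a b (c ℕ.* s)) ≡ (+ n′) / R
  norm≡ n′ N≡n′*4 = begin
    normK d ((X / (r ℕ.* s) , Y / (r ℕ.* s)) −K mkOS d a b (c ℕ.* s))
      ≡⟨ normK-−-mkOS-≡3 d d≡3 {r} {s} {c} X Y a b ⟩
    (+ (∣ A ∣ ℕ.* ∣ A ∣ ℕ.+ d ℕ.* (∣ B ∣ ℕ.* ∣ B ∣))) / (R ℕ.* 4)
      ≡⟨ ℚP./-cong (trans (cong (λ A → + (∣ A ∣ ℕ.* ∣ A ∣ ℕ.+ d ℕ.* (∣ B ∣ ℕ.* ∣ B ∣))) A≡B+2κ)
                           (trans (cong +_ N≡n′*4) (ℤP.pos-* n′ 4))) refl ⟩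
    (+ n′ ℤ.* + 4) / (R ℕ.* 4)
      ≡⟨ *-cancelʳ-/ 4 (+ n′) R ⟩
    (+ n′) / R ∎
    where open ≡-Reasoning

close-to-OS-≡3 : ∀ {d S} → All Prime S → MinusDOneMod4 d → FracHypothesis (discD d) S →
  ∀ {r s} .{{_ : NonZero r}} .{{_ : NonZero (r ℕ.* s)}} → SFree S r → InT S s →
  ∀ X Y → CloseToOS d S (X / (r ℕ.* s) , Y / (r ℕ.* s))
close-to-OS-≡3 {d} {S} S-prime d≡3 hyp {r} {s} r-free s∈T X Y =
  let c , b , c∈T , B-bound = InT-approximation {d} (subst (λ D → FracHypothesis D S) (discD-≡3 d d≡3) hyp) (Y ℤ.* + 2) r
      a , A-bound = nearest-odd-multiple (X ℤ.* + (2 ℕ.* c)) b r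
      cs∈T = InT-* c∈T s∈T
  in mkOS d a b (c ℕ.* s) {{proj₁ cs∈T}} , (a , b , c ℕ.* s , cs∈T , refl) ,
     NS-norm<1-≡3 {d} S-prime d≡3 {{proj₁ cs∈T}} r-free s∈T c∈T X Y a b A-bound
       (subst (λ B → ∣ B ∣ ℕ.* ∣ B ∣ ℕ.* d ℕ.< 3 ℕ.* (r ℕ.* r)) (cong (ℤ._- b ℤ.* + r) (Y*2*c≡ c)) B-bound)
  where
  Y*2*c≡ : ∀ c → Y ℤ.* + 2 ℤ.* + c ≡ Y ℤ.* + (2 ℕ.* c)
  Y*2*c≡ c = trans (ℤP.*-assoc Y (+ 2) (+ c)) (cong (Y ℤ.*_) (sym (ℤP.pos-* 2 c)))

record SCommonDenominator (S : List ℕ) (x y : ℚ) : Set where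
  field
    r s : ℕ
    X Y : ℤ
    {{r≢0}} : NonZero r
    {{rs≢0}} : NonZero (r ℕ.* s)
    r-free : SFree S r
    s∈T : InT S s
    x≡ : x ≡ X / (r ℕ.* s)
    y≡ : y ≡ Y / (r ℕ.* s)

common-denominator : ∀ {S} → All Prime S → ∀ x y → SCommonDenominator S x y
common-denominator {S} S-prime x y = over-SFree*InT (removeS-factorisation S S-prime M M≢0)
  where
  M = ↧ₙ x ℕ.* ↧ₙ y
  M≢0 : NonZero M
  M≢0 = _
  over-M : ∀ p k .{{_ : NonZero k}} .{{_ : NonZero (↧ₙ p ℕ.* k)}} → p ≡ (↥ p ℤ.* + k) / (↧ₙ p ℕ.* k)
  over-M p k = sym (trans (*-cancelʳ-/ k (↥ p) (↧ₙ p)) (ℚP.↥p/↧p≡p p))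
  over-SFree*InT : (∃ λ t → InT S t × M ≡ removeS S M ℕ.* t × SFree S (removeS S M)) → SCommonDenominator S x y
  over-SFree*InT (s , s∈T , M≡ , r-free) = record
    { r = removeS S M ; s = s ; X = ↥ x ℤ.* + ↧ₙ y ; Y = ↥ y ℤ.* + ↧ₙ x
    ; r-free = r-free ; s∈T = s∈T
    ; x≡ = trans (over-M x (↧ₙ y)) (/-congʳ (↥ x ℤ.* + ↧ₙ y) M≡)
    ; y≡ = trans (over-M y (↧ₙ x)) (/-congʳ (↥ y ℤ.* + ↧ₙ x) (trans (ℕP.*-comm (↧ₙ y) (↧ₙ x)) M≡))
    }
    where
    instance
      r≢0 : NonZero (removeS S M)
      r≢0 = removeS-nz S M M≢0
      rs≢0 : NonZero (removeS S M ℕ.* s)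
      rs≢0 = subst NonZero M≡ M≢0

close-to-OS : ∀ {d S} → All Prime S → FracHypothesis (discD d) S → Dec (MinusDOneMod4 d) →
  ∀ {r s} .{{_ : NonZero r}} .{{_ : NonZero (r ℕ.* s)}} → SFree S r → InT S s →
  ∀ X Y → CloseToOS d S (X / (r ℕ.* s) , Y / (r ℕ.* s))
close-to-OS {d} S-prime hyp (yes d≡3) r-free s∈T X Y = close-to-OS-≡3 {d} S-prime d≡3 hyp r-free s∈T X Y
close-to-OS {d} S-prime hyp (no d≢3) r-free s∈T X Y = close-to-OS-≢3 {d} S-prime d≢3 hyp r-free s∈T X Y

corollary1 : (d : ℕ) → NonZero d → Squarefree d →
    (S : List ℕ) → All Prime S →
    (∀ (y : ℚ) → 0ℚ ≤ y → y ≤ 1ℚ →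
    Σ ℕ λ c → Σ (InT S c) λ _ → FracCondition (discD d) ((+ c Data.Rational./ 1) * y)) →
    SNormEuclidean d S
corollary1 d _ _ S S-prime hyp (x , y) =
  let open SCommonDenominator (common-denominator S-prime x y)
  in subst (CloseToOS d S) (sym (cong₂ _,_ x≡ y≡))
           (close-to-OS {d} S-prime hyp (d ℕ.% 4 ℕ.≟ 3) {{r≢0}} {{rs≢0}} r-free s∈T X Y)
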